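{- Let $n\ge 1$, let $\mathbf{a}=(a_1,\dots,a_n)\in\mathbb{Z}_+^n$ and let $r\ge 0$ be an integer. Then the orbit of the monomial $x_0^r x^{\mathbf{a}}=x_0^r x_1^{a_1}\cdots x_n^{a_n}$ under the group $W_n$ is \[ \mathrm{Orbit}_{W_n}(x_0^r x^{\mathbf{a}})=\mathrm{Orbit}_{S_n}\big(\{x_0^r x_1^{\epsilon_1}\cdots x_n^{\epsilon_n}:\ \epsilon_i=a_i \text{ or } \epsilon_i=r-a_i\}\big)=\left\{x_0^r x_{\sigma(1)}^{\epsilon_{\sigma(1)}}\cdots x_{\sigma(n)}^{\epsilon_{\sigma(n)}}:\ \sigma\in S_n,\ \epsilon_i=a_i \text{ or } \epsilon_i=r-a_i\right\}. \]
   Context: $W_n$ denotes the group of $\mathbb{Q}$-automorphisms of the field $\mathbb{Q}(x_0,x_1,\dots,x_n)$ (equivalently of $\mathbb{Q}(x_0,x_1^{\pm1},\dots,x_n^{\pm1})$) generated by (i) the permutations of the variables $x_1,\dots,x_n$ (fixing $x_0$), and (ii) for $1\le i\le n$ the maps $\tau_i$ defined by $\tau_i(x_0)=x_0x_i$, $\tau_i(x_i)=x_i^{ -1}$, $\tau_i(x_j)=x_j$ for $j\ne i,0$. The symmetric group $S_n$ acts by permuting the subscripts of $x_1,\dots,x_n$. For $\mathbf{a}\in\mathbb{Z}^n$, $x^{\mathbf{a}}=x_1^{a_1}\cdots x_n^{a_n}$. -}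

module Defs where

open import Data.Nat using (ℕ)
open import Data.Integer using (ℤ; +_; _-_)
open import Data.Fin using (Fin; _≟_)
open import Data.Fin.Permutation using (Permutation′; _⟨$⟩ˡ_)
open import Data.Product using (_×_; _,_; Σ)
open import Data.List using (List; []; _∷_)
open import Relation.Nullary using (yes; no)
open import Relation.Binary.PropositionalEquality using (_≡_)

-- A Laurent monomial x_0^{e0} x_1^{e_1} ... x_n^{e_n} in Q(x_0,x_1^{±1},...,x_n^{±1}),
-- represented by its exponent data (e0 , e).
Mono : ℕ → Set
Mono n = ℤ × (Fin n → ℤ)

_≈M_ : ∀ {n} → Mono n → Mono n → Set
_≈M_ {n} (r , e) (s , f) = (r ≡ s) × ((i : Fin n) → e i ≡ f i)

data Gen (n : ℕ) : Set where
  perm : Permutation′ n → Gen n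
  tau  : Fin n → Gen n

-- Action of a generator on a monomial.
-- σ(x_i) = x_{σ(i)}: the exponent of x_j in σ(m) is the exponent of x_{σ⁻¹(j)} in m.
-- τ_i(x_0^{e0} x^e) = (x_0 x_i)^{e0} x_i^{-e_i} ∏_{j≠i} x_j^{e_j}.
actGen : ∀ {n} → Gen n → Mono n → Mono n
actGen (perm σ) (r , e) = r , (λ j → e (σ ⟨$⟩ˡ j))
actGen (tau i) (r , e) = r , (λ j → τe j)
  where
  τe : Fin _ → ℤ
  τe j with j ≟ i
  ... | yes _ = r - e j
  ... | no  _ = e j

-- Elements of W_n as words in the generators (the generating set is closed under
-- inverses: τ_i⁻¹ = τ_i, σ⁻¹ ∈ S_n, so words give the whole group).
Word : ℕ → Set
Word n = List (Gen n)

act : ∀ {n} → Word n → Mono n → Mono n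
act [] m = m
act (g ∷ w) m = actGen g (act w m)

InOrbitW : ∀ {n} → Mono n → Mono n → Set
InOrbitW {n} m m' = Σ (Word n) λ w → act w m ≈M m'

-- Each generator of W_n fixes the x_0-exponent r and acts on the remaining exponents
-- either by a permutation or by the reflection e_i ↦ r − e_i in a single coordinate.
-- Hence the monomials x_0^r x^(ε∘σ⁻¹), with σ a permutation and each ε_i equal to a_i or
-- r − a_i, form a W_n-stable set containing x_0^r x^a, so they contain its orbit.
-- Conversely, ε is reached from a by applying τ_i for every i with ε_i ≠ a_i, and a
-- final permutation moves the exponents into place.
module Submission where

open import Defs
open import Data.Nat using (ℕ; suc; _≥_)
open import Data.Integer using (ℤ; +_; _-_)
open import Data.Integer.Tactic.RingSolver using (solve-∀)
open import Data.Fin using (Fin; _≟_)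
open import Data.Fin.Permutation using (Permutation′; _⟨$⟩ˡ_; _⟨$⟩ʳ_; _∘ₚ_; id; inverseʳ)
open import Data.List using (List; []; _∷_; allFin)
open import Data.List.Relation.Unary.Any using (here; there)
open import Data.List.Membership.Propositional using (_∈_; _∉_)
open import Data.List.Membership.Propositional.Properties using (∈-allFin)
open import Data.Product using (_×_; _,_; Σ; proj₁; proj₂)
open import Data.Sum using (_⊎_; inj₁; inj₂)
open import Data.Empty using (⊥-elim)
open import Function.Bundles using (_⇔_; mk⇔)
open import Relation.Nullary using (yes; no)
open import Relation.Binary.PropositionalEquality
  using (_≡_; refl; sym; trans; cong; cong₂)

m-[m-n]≡n : ∀ (m n : ℤ) → m - (m - n) ≡ n
m-[m-n]≡n = solve-∀

⟨$⟩ˡ-injective : ∀ {n} (σ : Permutation′ n) {i j} → σ ⟨$⟩ˡ i ≡ σ ⟨$⟩ˡ j → i ≡ j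
⟨$⟩ˡ-injective σ {i} {j} eq =
  trans (sym (inverseʳ σ)) (trans (cong (σ ⟨$⟩ʳ_) eq) (inverseʳ σ))

module _ {n : ℕ} where

  open import Data.List.Membership.DecPropositional (_≟_ {n}) using (_∈?_)

  ≈M-sym : {m m′ : Mono n} → m ≈M m′ → m′ ≈M m
  ≈M-sym (p , q) = sym p , λ i → sym (q i)

  ≈M-trans : {m m′ m″ : Mono n} → m ≈M m′ → m′ ≈M m″ → m ≈M m″
  ≈M-trans (p , q) (p′ , q′) = trans p p′ , λ i → trans (q i) (q′ i)

  actGen-cong : (g : Gen n) {m m′ : Mono n} → m ≈M m′ → actGen g m ≈M actGen g m′
  actGen-cong (perm σ) (p , q) = p , λ j → q (σ ⟨$⟩ˡ j)
  actGen-cong (tau i) (p , q) = p , coordinate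
    where
    coordinate : ∀ j → proj₂ (actGen (tau i) _) j ≡ proj₂ (actGen (tau i) _) j
    coordinate j with j ≟ i
    ... | yes _ = cong₂ _-_ p (q j)
    ... | no  _ = q j

  proj₁-act : (w : Word n) (m : Mono n) → proj₁ (act w m) ≡ proj₁ m
  proj₁-act []           m = refl
  proj₁-act (perm _ ∷ w) m = proj₁-act w m
  proj₁-act (tau _ ∷ w)  m = proj₁-act w m

  reflectAt : ℤ → Fin n → (Fin n → ℤ) → Fin n → ℤ
  reflectAt r i e j with j ≟ i
  ... | yes _ = r - e j
  ... | no  _ = e j

  proj₂-actGen-tau : ∀ i r e j → proj₂ (actGen (tau i) (r , e)) j ≡ reflectAt r i e j
  proj₂-actGen-tau i r e j with j ≟ i
  ... | yes _ = refl
  ... | no  _ = refl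

  reflectAt-relabel : ∀ (σ : Permutation′ n) r i ε j →
    reflectAt r i (λ k → ε (σ ⟨$⟩ˡ k)) j ≡ reflectAt r (σ ⟨$⟩ˡ i) ε (σ ⟨$⟩ˡ j)
  reflectAt-relabel σ r i ε j with j ≟ i | σ ⟨$⟩ˡ j ≟ σ ⟨$⟩ˡ i
  ... | yes _   | yes _    = refl
  ... | yes j≡i | no σj≢σi = ⊥-elim (σj≢σi (cong (σ ⟨$⟩ˡ_) j≡i))
  ... | no j≢i  | yes σj≡σi = ⊥-elim (j≢i (⟨$⟩ˡ-injective σ σj≡σi))
  ... | no _    | no _     = refl

  PartialReflection : ℤ → (Fin n → ℤ) → (Fin n → ℤ) → Set
  PartialReflection r e ε = ∀ i → ε i ≡ e i ⊎ ε i ≡ r - e i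

  reflectAt-partialReflection : ∀ {r e ε} i →
    PartialReflection r e ε → PartialReflection r e (reflectAt r i ε)
  reflectAt-partialReflection {r} {e} {ε} i choice j with j ≟ i | choice j
  ... | yes _ | inj₁ εj≡ej   = inj₂ (cong (r -_) εj≡ej)
  ... | yes _ | inj₂ εj≡r-ej = inj₁ (trans (cong (r -_) εj≡r-ej) (m-[m-n]≡n r (e j)))
  ... | no  _ | εj          = εj

  ReflectionOrbit : ℤ → (Fin n → ℤ) → Mono n → Set
  ReflectionOrbit r e m = Σ (Permutation′ n) λ σ → Σ (Fin n → ℤ) λ ε →
    PartialReflection r e ε × (m ≈M (r , λ j → ε (σ ⟨$⟩ˡ j)))

  ReflectionOrbit-resp-≈M : ∀ {r e m m′} → m ≈M m′ →
    ReflectionOrbit r e m → ReflectionOrbit r e m′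
  ReflectionOrbit-resp-≈M m≈m′ (σ , ε , choice , m≈) = σ , ε , choice , ≈M-trans (≈M-sym m≈m′) m≈

  actGen-reflectionOrbit : ∀ {r e m} (g : Gen n) →
    ReflectionOrbit r e m → ReflectionOrbit r e (actGen g m)
  actGen-reflectionOrbit (perm τ) (σ , ε , choice , m≈) =
    σ ∘ₚ τ , ε , choice , actGen-cong (perm τ) m≈
  actGen-reflectionOrbit {r} (tau i) (σ , ε , choice , m≈) =
    σ , reflectAt r (σ ⟨$⟩ˡ i) ε , reflectAt-partialReflection (σ ⟨$⟩ˡ i) choice ,
    ≈M-trans (actGen-cong (tau i) m≈)
      (refl , λ j → trans (proj₂-actGen-tau i r _ j) (reflectAt-relabel σ r i ε j))

  act-reflectionOrbit : ∀ r e (w : Word n) → ReflectionOrbit r e (act w (r , e))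
  act-reflectionOrbit r e [] = id , e , (λ _ → inj₁ refl) , (refl , λ _ → refl)
  act-reflectionOrbit r e (g ∷ w) = actGen-reflectionOrbit g (act-reflectionOrbit r e w)

  ∉-tail : ∀ {x j : Fin n} {xs} → j ∉ x ∷ xs → j ∉ xs
  ∉-tail j∉ j∈ = j∉ (there j∈)

  ReflectsOn : ℤ → (Fin n → ℤ) → (Fin n → ℤ) → List (Fin n) → Word n → Set
  ReflectsOn r e ε xs w = (∀ j → j ∈ xs → proj₂ (act w (r , e)) j ≡ ε j)
                        × (∀ j → j ∉ xs → proj₂ (act w (r , e)) j ≡ e j)

  -- A coordinate already listed is never reflected a second time.
  reflectsOn : ∀ {r e ε} → PartialReflection r e ε → (xs : List (Fin n)) →
    Σ (Word n) (ReflectsOn r e ε xs)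
  reflectsOn choice [] = [] , (λ _ ()) , (λ _ _ → refl)
  reflectsOn {r} {e} {ε} choice (x ∷ xs) with reflectsOn choice xs | x ∈? xs
  ... | w , on , off | yes x∈xs = w , on′ , λ j j∉ → off j (∉-tail j∉)
    where
    on′ : ∀ j → j ∈ x ∷ xs → proj₂ (act w (r , e)) j ≡ ε j
    on′ j (here refl) = on j x∈xs
    on′ j (there j∈)  = on j j∈
  ... | w , on , off | no x∉xs with choice x
  ...   | inj₁ εx≡ex = w , on′ , λ j j∉ → off j (∉-tail j∉)
    where
    on′ : ∀ j → j ∈ x ∷ xs → proj₂ (act w (r , e)) j ≡ ε j
    on′ j (here refl) = trans (off j x∉xs) (sym εx≡ex)
    on′ j (there j∈)  = on j j∈
  ...   | inj₂ εx≡r-ex = tau x ∷ w , on′ , off′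
    where
    on′ : ∀ j → j ∈ x ∷ xs → proj₂ (act (tau x ∷ w) (r , e)) j ≡ ε j
    on′ j j∈ with j ≟ x | j∈
    ... | yes refl | _         = trans (cong₂ _-_ (proj₁-act w _) (off x x∉xs)) (sym εx≡r-ex)
    ... | no j≢x   | here j≡x  = ⊥-elim (j≢x j≡x)
    ... | no _     | there j∈′ = on j j∈′
    off′ : ∀ j → j ∉ x ∷ xs → proj₂ (act (tau x ∷ w) (r , e)) j ≡ e j
    off′ j j∉ with j ≟ x
    ... | yes j≡x = ⊥-elim (j∉ (here j≡x))
    ... | no _    = off j (∉-tail j∉)

  partialReflection-reachable : ∀ {r e ε} → PartialReflection r e ε →
    Σ (Word n) λ w → act w (r , e) ≈M (r , ε)
  partialReflection-reachable {r} {e} choice with reflectsOn choice (allFin n)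
  ... | w , on , _ = w , (proj₁-act w (r , e) , λ j → on j (∈-allFin j))

mainTheorem1 : (k : ℕ) (a : Fin (suc k) → ℕ) → ((i : Fin (suc k)) → a i ≥ 1) → (r : ℕ) →
    (m : Mono (suc k)) →
    InOrbitW (+ r , (λ i → + a i)) m ⇔
      Σ (Permutation′ (suc k)) λ σ → Σ (Fin (suc k) → ℤ) λ ε →
        ((i : Fin (suc k)) → (ε i ≡ + a i) ⊎ (ε i ≡ + r - + a i)) ×
        (m ≈M (+ r , (λ j → ε (σ ⟨$⟩ˡ j))))
mainTheorem1 k a _ r m = mk⇔ orbit⇒reflection reflection⇒orbit
  where
  e : Fin (suc k) → ℤ
  e i = + a i
  orbit⇒reflection : InOrbitW (+ r , e) m → ReflectionOrbit (+ r) e m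
  orbit⇒reflection (w , w≈m) = ReflectionOrbit-resp-≈M w≈m (act-reflectionOrbit (+ r) e w)
  reflection⇒orbit : ReflectionOrbit (+ r) e m → InOrbitW (+ r , e) m
  reflection⇒orbit (σ , ε , choice , m≈) with partialReflection-reachable choice
  ... | w , w≈ε = perm σ ∷ w , ≈M-trans (actGen-cong (perm σ) w≈ε) (≈M-sym m≈)
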